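{- For $d\in\mathbb{N}$ let $L_d=\sum_{k=0}^{d}\frac{(-1)^k}{k!}\binom{d}{k}X^k$ (the Laguerre polynomial of index $d$). For every integer $d\geq 2$, the $d$ real roots of $L_d$ are irrational. -}

module Defs where

open import Data.Nat as ℕ using (ℕ; zero; suc; _!)
open import Data.Nat.Properties using (_!≢0)
open import Data.Nat.Combinatorics using (_C_)
open import Data.Integer as ℤ using (ℤ; +_)
open import Data.Rational using (ℚ; _+_; _*_; -_; _/_; 0ℚ; 1ℚ)

_^ℚ_ : ℚ → ℕ → ℚ
q ^ℚ zero  = 1ℚ
q ^ℚ suc k = q * (q ^ℚ k)

sign : ℕ → ℚ
sign zero    = 1ℚ
sign (suc k) = - sign k

laguerreCoeff : ℕ → ℕ → ℚ
laguerreCoeff d k = sign k * (((+ (d C k)) / (k !)) {{k !≢0}})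

sumTo : ℕ → (ℕ → ℚ) → ℚ
sumTo zero    f = f 0
sumTo (suc n) f = sumTo n f + f (suc n)

laguerreEval : ℕ → ℚ → ℚ
laguerreEval d x = sumTo d (λ k → laguerreCoeff d k * (x ^ℚ k))

{-# OPTIONS --safe #-}
-- Write a rational root as n/m in lowest terms and clear denominators:
-- Σₖ (-1)ᵏ C(d,k) (d!/k!) nᵏ m^(d-k) = 0. A prime p ∣ d divides d!/k! for every k < d, so it
-- divides all terms except the last one, ±nᵈ; hence p ∣ n. If pᵉ exactly divides d!, then,
-- since the exponent of p in k! is less than k, p^(e+1) divides (d!/k!) nᵏ for every k ≥ 1, so
-- it also divides the remaining term d! mᵈ; hence p ∣ m, contradicting gcd(n, m) = 1.
module Submission where

open import Defs
open import Data.Empty using (⊥-elim)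
open import Data.List.Base using (_∷_)
open import Data.List.Relation.Unary.All using (_∷_)
open import Data.Nat
open import Data.Nat.Combinatorics using (_C_; nCn≡1)
import Data.Nat.Coprimality as Coprime
open import Data.Nat.Divisibility
open import Data.Nat.DivMod using (m≡m%n+[m/n]*n; m%n<n)
open import Data.Nat.Induction using (<-rec)
open import Data.Nat.ListAction using (product)
open import Data.Nat.Primality
open import Data.Nat.Primality.Factorisation using (factorise)
open import Data.Nat.Properties
open import Data.Nat.Solver using (module +-*-Solver)
open import Data.Integer as ℤ using (ℤ; +_; -1ℤ; 0ℤ)
import Data.Integer.Properties as ℤ
open import Data.Integer.Divisibility.Signed as ℤ using () renaming (_∣_ to _∣ℤ_)
open import Data.Rational as ℚ using (ℚ; 0ℚ; 1ℚ; mkℚ)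
import Data.Rational.Properties as ℚ
import Data.Rational.Solver as ℚ
import Data.Rational.Unnormalised as ℚᵘ
import Data.Rational.Unnormalised.Properties as ℚᵘ
open import Data.Product using (∃-syntax; _×_; _,_)
open import Data.Sum using (inj₁; inj₂)
open import Relation.Nullary using (¬_)
open import Relation.Binary.PropositionalEquality

Valuation : ℕ → ℕ → ℕ → Set
Valuation p n a = ∃[ u ] ¬ p ∣ u × n ≡ p ^ a * u

module _ {p : ℕ} (p-prime : Prime p) where

  private instance
    p-nonZero    = prime⇒nonZero p-prime
    p-nonTrivial = prime⇒nonTrivial p-prime

  p∤1 : ¬ p ∣ 1
  p∤1 p∣1 = nonTrivial⇒≢1 (∣1⇒≡1 p∣1)

  p∤m*n : ∀ {m n} → ¬ p ∣ m → ¬ p ∣ n → ¬ p ∣ m * n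
  p∤m*n {m} {n} p∤m p∤n p∣mn with euclidsLemma m n p-prime p∣mn
  ... | inj₁ p∣m = p∤m p∣m
  ... | inj₂ p∣n = p∤n p∣n

  p∣m^k⇒p∣m : ∀ {m} k → p ∣ m ^ k → p ∣ m
  p∣m^k⇒p∣m zero    p∣1 = ⊥-elim (p∤1 p∣1)
  p∣m^k⇒p∣m {m} (suc k) p∣m^[1+k] with euclidsLemma m (m ^ k) p-prime p∣m^[1+k]
  ... | inj₁ p∣m   = p∣m
  ... | inj₂ p∣m^k = p∣m^k⇒p∣m k p∣m^k

  p^e∣m*u⇒p^e∣m : ∀ {m u} e → ¬ p ∣ u → p ^ e ∣ m * u → p ^ e ∣ m
  p^e∣m*u⇒p^e∣m {m} zero    _   _ = 1∣ m
  p^e∣m*u⇒p^e∣m {m} {u} (suc e) p∤u p^[1+e]∣mu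
    with euclidsLemma m u p-prime (∣-trans (m∣m*n (p ^ e)) p^[1+e]∣mu)
  ... | inj₂ p∣u = ⊥-elim (p∤u p∣u)
  ... | inj₁ (divides m′ refl) =
    subst (p ^ suc e ∣_) (*-comm p m′)
      (*-monoʳ-∣ p (p^e∣m*u⇒p^e∣m e p∤u (*-cancelˡ-∣ p p^[1+e]∣p[m′u])))
    where
    p^[1+e]∣p[m′u] : p * p ^ e ∣ p * (m′ * u)
    p^[1+e]∣p[m′u] = subst (p * p ^ e ∣_) m′pu≡p[m′u] p^[1+e]∣mu
      where
      open +-*-Solver
      m′pu≡p[m′u] : m′ * p * u ≡ p * (m′ * u)
      m′pu≡p[m′u] = solve 3 (λ m p u → m :* p :* u := p :* (m :* u)) refl m′ p u

  [p*q+r]!≡[p*q]!*w : ∀ q {r} → r < p → ∃[ w ] ¬ p ∣ w × (p * q + r) ! ≡ (p * q) ! * w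
  [p*q+r]!≡[p*q]!*w q {zero}  _ =
    1 , p∤1 , trans (cong _! (+-identityʳ (p * q))) (sym (*-identityʳ ((p * q) !)))
  [p*q+r]!≡[p*q]!*w q {suc r} 1+r<p with [p*q+r]!≡[p*q]!*w q (<⇒≤ 1+r<p)
  ... | w , p∤w , eq = w * suc (p * q + r) , p∤m*n p∤w p∤1+pq+r , (begin
    (p * q + suc r) !                   ≡⟨ cong _! (+-suc (p * q) r) ⟩
    suc (p * q + r) * (p * q + r) !     ≡⟨ cong (suc (p * q + r) *_) eq ⟩
    suc (p * q + r) * ((p * q) ! * w)   ≡⟨ *-comm (suc (p * q + r)) ((p * q) ! * w) ⟩
    (p * q) ! * w * suc (p * q + r)     ≡⟨ *-assoc ((p * q) !) w (suc (p * q + r)) ⟩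
    (p * q) ! * (w * suc (p * q + r))   ∎)
    where
    open ≡-Reasoning
    p∤1+pq+r : ¬ p ∣ suc (p * q + r)
    p∤1+pq+r p∣1+pq+r = <⇒≱ 1+r<p
      (∣⇒≤ (∣m+n∣m⇒∣n (subst (p ∣_) (sym (+-suc (p * q) r)) p∣1+pq+r) (m∣m*n q)))

  [p*q]!≡p^q*q!*u : ∀ q → ∃[ u ] ¬ p ∣ u × (p * q) ! ≡ p ^ q * q ! * u
  [p*q]!≡p^q*q!*u zero = 1 , p∤1 , cong _! (*-zeroʳ p)
  [p*q]!≡p^q*q!*u (suc q) with [p*q]!≡p^q*q!*u q | [p*q+r]!≡[p*q]!*w q (≤-reflexive (suc-pred p))
  ... | u , p∤u , IH | w , p∤w , eq = u * w , p∤m*n p∤u p∤w , (begin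
    (p * suc q) !                              ≡⟨ cong _! p*[1+q]≡1+[p*q+p-1] ⟩
    suc (p * q + pred p) * (p * q + pred p) !  ≡⟨ cong (suc (p * q + pred p) *_) eq ⟩
    suc (p * q + pred p) * ((p * q) ! * w)     ≡⟨ cong (_* ((p * q) ! * w)) p*[1+q]≡1+[p*q+p-1] ⟨
    p * suc q * ((p * q) ! * w)                ≡⟨ cong (λ z → p * suc q * (z * w)) IH ⟩
    p * suc q * (p ^ q * q ! * u * w)          ≡⟨ rearrange p q (p ^ q) (q !) u w ⟩
    p ^ suc q * suc q ! * (u * w)              ∎)
    where
    open ≡-Reasoning
    open +-*-Solver
    p*[1+q]≡1+[p*q+p-1] : p * suc q ≡ suc (p * q + pred p)
    p*[1+q]≡1+[p*q+p-1] = begin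
      p * suc q              ≡⟨ *-suc p q ⟩
      p + p * q              ≡⟨ +-comm p (p * q) ⟩
      p * q + p              ≡⟨ cong (λ r → p * q + r) (suc-pred p) ⟨
      p * q + suc (pred p)   ≡⟨ +-suc (p * q) (pred p) ⟩
      suc (p * q + pred p)   ∎
    rearrange : ∀ p q a b u w → p * suc q * (a * b * u * w) ≡ p * a * (suc q * b) * (u * w)
    rearrange = solve 6 (λ p q a b u w → p :* (con 1 :+ q) :* (a :* b :* u :* w)
                                         := p :* a :* ((con 1 :+ q) :* b) :* (u :* w)) refl

  k≡p*[k/p]+k%p : ∀ k → k ≡ p * (k / p) + k % p
  k≡p*[k/p]+k%p k =
    trans (m≡m%n+[m/n]*n k p) (trans (+-comm (k % p) (k / p * p)) (cong (_+ k % p) (*-comm (k / p) p)))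

  k!≡p^[k/p]*[k/p]!*u : ∀ k → ∃[ u ] ¬ p ∣ u × k ! ≡ p ^ (k / p) * (k / p) ! * u
  k!≡p^[k/p]*[k/p]!*u k with [p*q]!≡p^q*q!*u (k / p) | [p*q+r]!≡[p*q]!*w (k / p) (m%n<n k p)
  ... | u , p∤u , eq₁ | w , p∤w , eq₂ = u * w , p∤m*n p∤u p∤w , (begin
    k !                              ≡⟨ cong _! (k≡p*[k/p]+k%p k) ⟩
    (p * q + k % p) !                ≡⟨ eq₂ ⟩
    (p * q) ! * w                    ≡⟨ cong (_* w) eq₁ ⟩
    p ^ q * q ! * u * w              ≡⟨ *-assoc (p ^ q * q !) u w ⟩
    p ^ q * q ! * (u * w)            ∎)
    where
    open ≡-Reasoning
    q = k / p

  -- With q = ⌊k/p⌋ and k! = p^q q! u, the exponent is q + v(q!) < 2q ≤ pq ≤ k.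
  valuation[k!]<k : ∀ k → 0 < k → ∃[ a ] a < k × Valuation p (k !) a
  valuation[k!]<k = <-rec _ step
    where
    step : ∀ k → (∀ {j} → j < k → 0 < j → ∃[ a ] a < j × Valuation p (j !) a) →
           0 < k → ∃[ a ] a < k × Valuation p (k !) a
    step k rec 0<k with k!≡p^[k/p]*[k/p]!*u k
    ... | u , p∤u , k!≡ =
      combine (k / p) (subst (p * (k / p) ≤_) (sym (k≡p*[k/p]+k%p k)) (m≤m+n (p * (k / p)) (k % p))) k!≡
      where
      combine : ∀ q → p * q ≤ k → k ! ≡ p ^ q * q ! * u → ∃[ a ] a < k × Valuation p (k !) a
      combine zero    _    k!≡′ = 0 , 0<k , u , p∤u , k!≡′
      combine (suc q) pq≤k k!≡′ with rec 1+q<k z<s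
        where
        1+q<k : suc q < k
        1+q<k = <-≤-trans (m<m*n (suc q) p (nonTrivial⇒n>1 p)) (subst (_≤ k) (*-comm p (suc q)) pq≤k)
      ... | b , b<1+q , v , p∤v , [1+q]!≡ =
        suc q + b , 1+q+b<k , v * u , p∤m*n p∤v p∤u , k!≡p^[1+q+b]*vu
        where
        1+q+b<k : suc q + b < k
        1+q+b<k = begin-strict
          suc q + b            <⟨ +-monoʳ-< (suc q) b<1+q ⟩
          suc q + suc q        ≡⟨ cong (λ r → suc q + r) (+-identityʳ (suc q)) ⟨
          2 * suc q            ≤⟨ *-monoˡ-≤ (suc q) (nonTrivial⇒n>1 p) ⟩
          p * suc q            ≤⟨ pq≤k ⟩
          k                    ∎
          where open ≤-Reasoning
        k!≡p^[1+q+b]*vu : k ! ≡ p ^ (suc q + b) * (v * u)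
        k!≡p^[1+q+b]*vu = begin
          k !                               ≡⟨ k!≡′ ⟩
          p ^ suc q * suc q ! * u           ≡⟨ cong (λ z → p ^ suc q * z * u) [1+q]!≡ ⟩
          p ^ suc q * (p ^ b * v) * u       ≡⟨ rearrange (p ^ suc q) (p ^ b) v u ⟩
          p ^ suc q * p ^ b * (v * u)       ≡⟨ cong (_* (v * u)) (^-distribˡ-+-* p (suc q) b) ⟨
          p ^ (suc q + b) * (v * u)         ∎
          where
          open ≡-Reasoning
          open +-*-Solver
          rearrange : ∀ a b v u → a * (b * v) * u ≡ a * b * (v * u)
          rearrange = solve 4 (λ a b v u → a :* (b :* v) :* u := a :* b :* (v :* u)) refl

  p^e∣F*k!⇒p^[1+e]∣F*p^k : ∀ {e F k} → 0 < k → p ^ e ∣ F * k ! → p ^ suc e ∣ F * p ^ k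
  p^e∣F*k!⇒p^[1+e]∣F*p^k {e} {F} {k} 0<k p^e∣F*k! with valuation[k!]<k k 0<k
  ... | a , a<k , u , p∤u , k!≡p^a*u =
    subst₂ _∣_ (*-comm (p ^ e) p) F*p^a*p^[1+c]≡F*p^k (*-pres-∣ p^e∣F*p^a (m∣m*n (p ^ c)))
    where
    c = k ∸ suc a
    p^e∣F*p^a : p ^ e ∣ F * p ^ a
    p^e∣F*p^a = p^e∣m*u⇒p^e∣m e p∤u
      (subst (p ^ e ∣_) (trans (cong (F *_) k!≡p^a*u) (sym (*-assoc F (p ^ a) u))) p^e∣F*k!)
    F*p^a*p^[1+c]≡F*p^k : F * p ^ a * (p * p ^ c) ≡ F * p ^ k
    F*p^a*p^[1+c]≡F*p^k = begin
      F * p ^ a * p ^ suc c     ≡⟨ *-assoc F (p ^ a) (p ^ suc c) ⟩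
      F * (p ^ a * p ^ suc c)   ≡⟨ cong (F *_) (^-distribˡ-+-* p a (suc c)) ⟨
      F * p ^ (a + suc c)       ≡⟨ cong (λ i → F * p ^ i) (trans (+-suc a c) (m+[n∸m]≡n a<k)) ⟩
      F * p ^ k                 ∎
      where open ≡-Reasoning

  p^[1+e]∣p^e*u*m⇒p∣m : ∀ {e u m} → ¬ p ∣ u → p ^ suc e ∣ p ^ e * u * m → p ∣ m
  p^[1+e]∣p^e*u*m⇒p∣m {e} {u} {m} p∤u p^[1+e]∣p^e*u*m
    with euclidsLemma u m p-prime (*-cancelˡ-∣ (p ^ e) {{m^n≢0 p e}} p^e*p∣p^e*[u*m])
    where
    p^e*p∣p^e*[u*m] : p ^ e * p ∣ p ^ e * (u * m)
    p^e*p∣p^e*[u*m] = subst₂ _∣_ (*-comm p (p ^ e)) (*-assoc (p ^ e) u m) p^[1+e]∣p^e*u*m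
  ... | inj₁ p∣u = ⊥-elim (p∤u p∣u)
  ... | inj₂ p∣m = p∣m

∃-prime∣ : ∀ {n} → 2 ≤ n → ∃[ p ] Prime p × p ∣ n
∃-prime∣ {1} (s≤s ())
∃-prime∣ {n@(suc (suc _))} _ with factorise n
... | record { factors = p ∷ ps ; isFactorisation = n≡p*∏ps ; factorsPrime = p-prime ∷ _ } =
  p , p-prime , divides (product ps) (trans n≡p*∏ps (*-comm p (product ps)))

^-monoˡ-∣ : ∀ {m n} k → m ∣ n → m ^ k ∣ n ^ k
^-monoˡ-∣ zero    _   = ∣-refl
^-monoˡ-∣ (suc k) m∣n = *-pres-∣ m∣n (^-monoˡ-∣ k m∣n)

∣i^n∣≡∣i∣^n : ∀ i n → ℤ.∣ i ℤ.^ n ∣ ≡ ℤ.∣ i ∣ ^ n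
∣i^n∣≡∣i∣^n i zero    = refl
∣i^n∣≡∣i∣^n i (suc n) = trans (ℤ.abs-* i (i ℤ.^ n)) (cong (ℤ.∣ i ∣ *_) (∣i^n∣≡∣i∣^n i n))

sumToℤ : ℕ → (ℕ → ℤ) → ℤ
sumToℤ zero    f = f 0
sumToℤ (suc n) f = sumToℤ n f ℤ.+ f (suc n)

module _ {i : ℤ} where

  ∣-sumToℤ : ∀ n {f} → (∀ k → k ≤ n → i ∣ℤ f k) → i ∣ℤ sumToℤ n f
  ∣-sumToℤ zero    i∣f = i∣f 0 z≤n
  ∣-sumToℤ (suc n) i∣f = ℤ.∣m∣n⇒∣m+n (∣-sumToℤ n (λ k k≤n → i∣f k (m≤n⇒m≤1+n k≤n))) (i∣f (suc n) ≤-refl)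

  ∣sumToℤ⇒∣last : ∀ n {f} → i ∣ℤ sumToℤ (suc n) f → (∀ k → k ≤ n → i ∣ℤ f k) → i ∣ℤ f (suc n)
  ∣sumToℤ⇒∣last n i∣sum i∣f = ℤ.∣m+n∣m⇒∣n i∣sum (∣-sumToℤ n i∣f)

  ∣sumToℤ⇒∣head : ∀ n {f} → i ∣ℤ sumToℤ n f → (∀ k → 0 < k → k ≤ n → i ∣ℤ f k) → i ∣ℤ f 0
  ∣sumToℤ⇒∣head zero    i∣sum _   = i∣sum
  ∣sumToℤ⇒∣head (suc n) i∣sum i∣f = ∣sumToℤ⇒∣head n (ℤ.∣m+n∣n⇒∣m i∣sum (i∣f (suc n) z<s ≤-refl))
    (λ k 0<k k≤n → i∣f k 0<k (m≤n⇒m≤1+n k≤n))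

  ∣0ℤ : i ∣ℤ 0ℤ
  ∣0ℤ = ℤ.∣ᵤ⇒∣ (ℤ.∣ i ∣ ∣0)

fromℚᵘ-homo-+ : ∀ p q → ℚ.fromℚᵘ (p ℚᵘ.+ q) ≡ ℚ.fromℚᵘ p ℚ.+ ℚ.fromℚᵘ q
fromℚᵘ-homo-+ p q = ℚ.toℚᵘ-injective (ℚᵘ.≃-trans (ℚ.toℚᵘ-fromℚᵘ (p ℚᵘ.+ q)) (ℚᵘ.≃-sym (ℚᵘ.≃-trans
  (ℚ.toℚᵘ-homo-+ (ℚ.fromℚᵘ p) (ℚ.fromℚᵘ q)) (ℚᵘ.+-cong (ℚ.toℚᵘ-fromℚᵘ p) (ℚ.toℚᵘ-fromℚᵘ q)))))

fromℚᵘ-homo-* : ∀ p q → ℚ.fromℚᵘ (p ℚᵘ.* q) ≡ ℚ.fromℚᵘ p ℚ.* ℚ.fromℚᵘ q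
fromℚᵘ-homo-* p q = ℚ.toℚᵘ-injective (ℚᵘ.≃-trans (ℚ.toℚᵘ-fromℚᵘ (p ℚᵘ.* q)) (ℚᵘ.≃-sym (ℚᵘ.≃-trans
  (ℚ.toℚᵘ-homo-* (ℚ.fromℚᵘ p) (ℚ.fromℚᵘ q)) (ℚᵘ.*-cong (ℚ.toℚᵘ-fromℚᵘ p) (ℚ.toℚᵘ-fromℚᵘ q)))))

ι : ℤ → ℚ
ι i = ℚ.fromℚᵘ (ℚᵘ.mkℚᵘ i 0)

ι-homo-+ : ∀ i j → ι (i ℤ.+ j) ≡ ι i ℚ.+ ι j
ι-homo-+ i j = trans
  (ℚ.fromℚᵘ-cong {ℚᵘ.mkℚᵘ (i ℤ.+ j) 0} {ℚᵘ.mkℚᵘ i 0 ℚᵘ.+ ℚᵘ.mkℚᵘ j 0}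
    (ℚᵘ.*≡* (cong (ℤ._* + 1) (sym (cong₂ ℤ._+_ (ℤ.*-identityʳ i) (ℤ.*-identityʳ j))))))
  (fromℚᵘ-homo-+ (ℚᵘ.mkℚᵘ i 0) (ℚᵘ.mkℚᵘ j 0))

ι-homo-* : ∀ i j → ι (i ℤ.* j) ≡ ι i ℚ.* ι j
ι-homo-* i j = trans
  (ℚ.fromℚᵘ-cong {ℚᵘ.mkℚᵘ (i ℤ.* j) 0} {ℚᵘ.mkℚᵘ i 0 ℚᵘ.* ℚᵘ.mkℚᵘ j 0} (ℚᵘ.*≡* refl))
  (fromℚᵘ-homo-* (ℚᵘ.mkℚᵘ i 0) (ℚᵘ.mkℚᵘ j 0))

ι-homo-^ : ∀ i k → ι (i ℤ.^ k) ≡ ι i ^ℚ k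
ι-homo-^ i zero    = refl
ι-homo-^ i (suc k) = trans (ι-homo-* i (i ℤ.^ k)) (cong (ι i ℚ.*_) (ι-homo-^ i k))

ι-injective : ∀ {i j} → ι i ≡ ι j → i ≡ j
ι-injective {i} {j} ιi≡ιj with ℚ.fromℚᵘ-injective {ℚᵘ.mkℚᵘ i 0} {ℚᵘ.mkℚᵘ j 0} ιi≡ιj
... | ℚᵘ.*≡* i*1≡j*1 = trans (sym (ℤ.*-identityʳ i)) (trans i*1≡j*1 (ℤ.*-identityʳ j))

ι[n]*[i/n]≡ι[i] : ∀ n .{{_ : NonZero n}} i → ι (+ n) ℚ.* (i ℚ./ n) ≡ ι i
ι[n]*[i/n]≡ι[i] (suc m) i = trans (sym (fromℚᵘ-homo-* (ℚᵘ.mkℚᵘ (+ suc m) 0) (ℚᵘ.mkℚᵘ i m)))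
  (ℚ.fromℚᵘ-cong {ℚᵘ.mkℚᵘ (+ suc m) 0 ℚᵘ.* ℚᵘ.mkℚᵘ i m} {ℚᵘ.mkℚᵘ i 0}
    (ℚᵘ.*≡* (trans (ℤ.*-identityʳ _) (trans (ℤ.*-comm (+ suc m) i)
      (cong (λ n → i ℤ.* + n) (sym (*-identityˡ (suc m))))))))

ι[-1^k]≡sign : ∀ k → ι (-1ℤ ℤ.^ k) ≡ sign k
ι[-1^k]≡sign zero    = refl
ι[-1^k]≡sign (suc k) = begin
  ι (-1ℤ ℤ.* -1ℤ ℤ.^ k)      ≡⟨ ι-homo-* -1ℤ (-1ℤ ℤ.^ k) ⟩
  ℚ.- 1ℚ ℚ.* ι (-1ℤ ℤ.^ k)   ≡⟨ cong (ℚ.- 1ℚ ℚ.*_) (ι[-1^k]≡sign k) ⟩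
  ℚ.- 1ℚ ℚ.* sign k           ≡⟨ ℚ.neg-distribˡ-* 1ℚ (sign k) ⟨
  ℚ.- (1ℚ ℚ.* sign k)         ≡⟨ cong ℚ.-_ (ℚ.*-identityˡ (sign k)) ⟩
  ℚ.- sign k                  ∎
  where open ≡-Reasoning

ι-sumToℤ : ∀ n f → ι (sumToℤ n f) ≡ sumTo n (λ k → ι (f k))
ι-sumToℤ zero    f = refl
ι-sumToℤ (suc n) f = trans (ι-homo-+ (sumToℤ n f) (f (suc n))) (cong (ℚ._+ ι (f (suc n))) (ι-sumToℤ n f))

sumTo-cong : ∀ n {f g : ℕ → ℚ} → (∀ k → k ≤ n → f k ≡ g k) → sumTo n f ≡ sumTo n g
sumTo-cong zero    f≗g = f≗g 0 z≤n
sumTo-cong (suc n) f≗g = cong₂ ℚ._+_ (sumTo-cong n (λ k k≤n → f≗g k (m≤n⇒m≤1+n k≤n))) (f≗g (suc n) ≤-refl)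

*-distribˡ-sumTo : ∀ c n f → c ℚ.* sumTo n f ≡ sumTo n (λ k → c ℚ.* f k)
*-distribˡ-sumTo c zero    f = refl
*-distribˡ-sumTo c (suc n) f = trans (ℚ.*-distribˡ-+ c (sumTo n f) (f (suc n)))
  (cong (ℚ._+ c ℚ.* f (suc n)) (*-distribˡ-sumTo c n f))

*-distrib-^ℚ : ∀ p q k → (p ℚ.* q) ^ℚ k ≡ p ^ℚ k ℚ.* q ^ℚ k
*-distrib-^ℚ p q zero    = sym (ℚ.*-identityˡ 1ℚ)
*-distrib-^ℚ p q (suc k) = trans (cong (p ℚ.* q ℚ.*_) (*-distrib-^ℚ p q k))
  (solve 4 (λ p q a b → (p :* q) :* (a :* b) := (p :* a) :* (q :* b)) refl p q (p ^ℚ k) (q ^ℚ k))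
  where open ℚ.+-*-Solver

factorialRatio : ℕ → ℕ → ℕ
factorialRatio k zero    = 1
factorialRatio k (suc j) = suc (k + j) * factorialRatio k j

[k+j]!≡factorialRatio*k! : ∀ k j → (k + j) ! ≡ factorialRatio k j * k !
[k+j]!≡factorialRatio*k! k zero    = trans (cong _! (+-identityʳ k)) (sym (*-identityˡ (k !)))
[k+j]!≡factorialRatio*k! k (suc j) = begin
  (k + suc j) !                            ≡⟨ cong _! (+-suc k j) ⟩
  suc (k + j) * (k + j) !                  ≡⟨ cong (suc (k + j) *_) ([k+j]!≡factorialRatio*k! k j) ⟩
  suc (k + j) * (factorialRatio k j * k !) ≡⟨ *-assoc (suc (k + j)) (factorialRatio k j) (k !) ⟨
  factorialRatio k (suc j) * k !           ∎
  where open ≡-Reasoning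

d∣factorialRatio : ∀ {k d} → k < d → d ∣ factorialRatio k (d ∸ k)
d∣factorialRatio {k} {suc d} (s≤s k≤d) =
  subst (λ j → suc d ∣ factorialRatio k j) (sym (+-∸-assoc 1 k≤d))
    (subst (_∣ factorialRatio k (suc (d ∸ k))) (cong suc (m+[n∸m]≡n k≤d)) (m∣m*n (factorialRatio k (d ∸ k))))

laguerreTerm : ℕ → ℤ → ℤ → ℕ → ℤ
laguerreTerm d n m k =
  -1ℤ ℤ.^ k ℤ.* + (d C k) ℤ.* (+ factorialRatio k (d ∸ k) ℤ.* n ℤ.^ k) ℤ.* m ℤ.^ (d ∸ k)

laguerreTerm-first : ∀ d n m → laguerreTerm d n m 0 ≡ + (d !) ℤ.* m ℤ.^ d
laguerreTerm-first d n m = cong (ℤ._* m ℤ.^ d) (trans (ℤ.*-identityˡ _) (trans (ℤ.*-identityʳ _)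
  (cong +_ (trans (sym (*-identityʳ (factorialRatio 0 d))) (sym ([k+j]!≡factorialRatio*k! 0 d))))))

laguerreTerm-last : ∀ d n m → laguerreTerm d n m d ≡ -1ℤ ℤ.^ d ℤ.* n ℤ.^ d
laguerreTerm-last d n m rewrite nCn≡1 d | n∸n≡0 d =
  trans (ℤ.*-identityʳ _) (trans (cong (-1ℤ ℤ.^ d ℤ.* + 1 ℤ.*_) (ℤ.*-identityˡ (n ℤ.^ d)))
    (cong (ℤ._* n ℤ.^ d) (ℤ.*-identityʳ (-1ℤ ℤ.^ d))))

module _ {m n : ℤ} {x : ℚ} (mx≡n : ι m ℚ.* x ≡ ι n) where

  clearDenominator-term : ∀ {d k} → k ≤ d →
    ι (+ (d !) ℤ.* m ℤ.^ d) ℚ.* (laguerreCoeff d k ℚ.* x ^ℚ k) ≡ ι (laguerreTerm d n m k)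
  clearDenominator-term {d} {k} k≤d = begin
    ι (+ (d !) ℤ.* m ℤ.^ d) ℚ.* (sign k ℚ.* c ℚ.* x ^ℚ k)
      ≡⟨ cong (ℚ._* (sign k ℚ.* c ℚ.* x ^ℚ k)) ι[d!*m^d]≡F*K*[mᵏ*mʲ] ⟩
    F ℚ.* K ℚ.* (ι m ^ℚ k ℚ.* M) ℚ.* (sign k ℚ.* c ℚ.* x ^ℚ k)
      ≡⟨ solve 7 (λ f kk mk mj s c xk → f :* kk :* (mk :* mj) :* (s :* c :* xk)
                                      := s :* (kk :* c) :* (f :* (mk :* xk)) :* mj)
               refl F K (ι m ^ℚ k) M (sign k) c (x ^ℚ k) ⟩
    sign k ℚ.* (K ℚ.* c) ℚ.* (F ℚ.* (ι m ^ℚ k ℚ.* x ^ℚ k)) ℚ.* M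
      ≡⟨ cong₂ (λ a b → sign k ℚ.* a ℚ.* (F ℚ.* b) ℚ.* M)
               (ι[n]*[i/n]≡ι[i] (k !) {{k !≢0}} (+ (d C k))) mᵏxᵏ≡nᵏ ⟩
    sign k ℚ.* ι (+ (d C k)) ℚ.* (F ℚ.* ι n ^ℚ k) ℚ.* M
      ≡⟨ cong₂ (λ a b → a ℚ.* ι (+ (d C k)) ℚ.* (F ℚ.* b) ℚ.* M) (ι[-1^k]≡sign k) (ι-homo-^ n k) ⟨
    ι (-1ℤ ℤ.^ k) ℚ.* ι (+ (d C k)) ℚ.* (F ℚ.* ι (n ℤ.^ k)) ℚ.* M
      ≡⟨ ι[laguerreTerm]≡ ⟨
    ι (laguerreTerm d n m k) ∎
    where
    open ≡-Reasoning
    open ℚ.+-*-Solver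
    j = d ∸ k
    c = (+ (d C k) ℚ./ k !) {{k !≢0}}
    F = ι (+ factorialRatio k j)
    K = ι (+ (k !))
    M = ι m ^ℚ j
    sC = -1ℤ ℤ.^ k ℤ.* + (d C k)
    Fnᵏ = + factorialRatio k j ℤ.* n ℤ.^ k

    ι[d!*m^d]≡F*K*[mᵏ*mʲ] : ι (+ (d !) ℤ.* m ℤ.^ d) ≡ F ℚ.* K ℚ.* (ι m ^ℚ k ℚ.* M)
    ι[d!*m^d]≡F*K*[mᵏ*mʲ] = begin
      ι (+ (d !) ℤ.* m ℤ.^ d)
        ≡⟨ cong (λ e → ι (+ (e !) ℤ.* m ℤ.^ e)) (m+[n∸m]≡n k≤d) ⟨
      ι (+ ((k + j) !) ℤ.* m ℤ.^ (k + j))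
        ≡⟨ cong₂ (λ a b → ι (a ℤ.* b))
                 (trans (cong +_ ([k+j]!≡factorialRatio*k! k j)) (ℤ.pos-* (factorialRatio k j) (k !)))
                 (ℤ.^-distribˡ-+-* m k j) ⟩
      ι (+ factorialRatio k j ℤ.* + (k !) ℤ.* (m ℤ.^ k ℤ.* m ℤ.^ j))
        ≡⟨ trans (ι-homo-* (+ factorialRatio k j ℤ.* + (k !)) (m ℤ.^ k ℤ.* m ℤ.^ j))
                 (cong₂ ℚ._*_ (ι-homo-* (+ factorialRatio k j) (+ (k !)))
                     (trans (ι-homo-* (m ℤ.^ k) (m ℤ.^ j)) (cong₂ ℚ._*_ (ι-homo-^ m k) (ι-homo-^ m j)))) ⟩
      F ℚ.* K ℚ.* (ι m ^ℚ k ℚ.* M) ∎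

    mᵏxᵏ≡nᵏ : ι m ^ℚ k ℚ.* x ^ℚ k ≡ ι n ^ℚ k
    mᵏxᵏ≡nᵏ = trans (sym (*-distrib-^ℚ (ι m) x k)) (cong (_^ℚ k) mx≡n)

    ι[laguerreTerm]≡ :
      ι (laguerreTerm d n m k) ≡ ι (-1ℤ ℤ.^ k) ℚ.* ι (+ (d C k)) ℚ.* (F ℚ.* ι (n ℤ.^ k)) ℚ.* M
    ι[laguerreTerm]≡ =
      trans (ι-homo-* (sC ℤ.* Fnᵏ) (m ℤ.^ j)) (cong₂ ℚ._*_
        (trans (ι-homo-* sC Fnᵏ) (cong₂ ℚ._*_ (ι-homo-* (-1ℤ ℤ.^ k) (+ (d C k)))
                                               (ι-homo-* (+ factorialRatio k j) (n ℤ.^ k))))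
        (ι-homo-^ m j))

  laguerreRoot⇒sumToℤ≡0 : ∀ d → laguerreEval d x ≡ 0ℚ → sumToℤ d (laguerreTerm d n m) ≡ 0ℤ
  laguerreRoot⇒sumToℤ≡0 d root = ι-injective (begin
    ι (sumToℤ d (laguerreTerm d n m))
      ≡⟨ ι-sumToℤ d (laguerreTerm d n m) ⟩
    sumTo d (λ k → ι (laguerreTerm d n m k))
      ≡⟨ sumTo-cong d (λ k → clearDenominator-term) ⟨
    sumTo d (λ k → ι D ℚ.* (laguerreCoeff d k ℚ.* x ^ℚ k))
      ≡⟨ *-distribˡ-sumTo (ι D) d (λ k → laguerreCoeff d k ℚ.* x ^ℚ k) ⟨
    ι D ℚ.* laguerreEval d x
      ≡⟨ cong (ι D ℚ.*_) root ⟩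
    ι D ℚ.* 0ℚ
      ≡⟨ ℚ.*-zeroʳ (ι D) ⟩
    0ℚ ∎)
    where
    open ≡-Reasoning
    D = + (d !) ℤ.* m ℤ.^ d

module _ {p d : ℕ} {n m : ℤ} where

  p∣laguerreTerm : p ∣ d → ∀ k → k < d → + p ∣ℤ laguerreTerm d n m k
  p∣laguerreTerm p∣d k k<d =
    ℤ.∣m⇒∣m*n (m ℤ.^ (d ∸ k)) (ℤ.∣n⇒∣m*n (-1ℤ ℤ.^ k ℤ.* + (d C k))
      (ℤ.∣m⇒∣m*n (n ℤ.^ k) (ℤ.∣ᵤ⇒∣ {i = + factorialRatio k (d ∸ k)}
        (∣-trans p∣d (d∣factorialRatio k<d)))))

  p^[1+e]∣laguerreTerm : Prime p → p ∣ ℤ.∣ n ∣ → ∀ {e} → p ^ e ∣ d ! →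
                         ∀ k → 0 < k → k ≤ d → + (p ^ suc e) ∣ℤ laguerreTerm d n m k
  p^[1+e]∣laguerreTerm p-prime p∣n {e} p^e∣d! k 0<k k≤d =
    ℤ.∣m⇒∣m*n (m ℤ.^ j) (ℤ.∣n⇒∣m*n (-1ℤ ℤ.^ k ℤ.* + (d C k)) (ℤ.∣ᵤ⇒∣ (subst (p ^ suc e ∣_) (sym ∣Fnᵏ∣≡)
      (∣-trans (p^e∣F*k!⇒p^[1+e]∣F*p^k p-prime {e} {F} 0<k p^e∣F*k!)
               (*-monoʳ-∣ F (^-monoˡ-∣ k p∣n))))))
    where
    j = d ∸ k
    F = factorialRatio k j
    p^e∣F*k! : p ^ e ∣ F * k !
    p^e∣F*k! =
      subst (p ^ e ∣_) (trans (cong _! (sym (m+[n∸m]≡n k≤d))) ([k+j]!≡factorialRatio*k! k j)) p^e∣d!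
    ∣Fnᵏ∣≡ : ℤ.∣ + F ℤ.* n ℤ.^ k ∣ ≡ F * ℤ.∣ n ∣ ^ k
    ∣Fnᵏ∣≡ = trans (ℤ.abs-* (+ F) (n ℤ.^ k)) (cong (F *_) (∣i^n∣≡∣i∣^n n k))

module _ {p : ℕ} (p-prime : Prime p) {n m : ℤ} where

  p∣d⇒p∣n : ∀ {d} → sumToℤ d (laguerreTerm d n m) ≡ 0ℤ → p ∣ d → p ∣ ℤ.∣ n ∣
  p∣d⇒p∣n {zero}  ()
  p∣d⇒p∣n {suc d} sum≡0 p∣d = p∣m^k⇒p∣m p-prime (suc d) (subst (p ∣_) ∣last∣≡ (ℤ.∣⇒∣ᵤ p∣last))
    where
    p∣last : + p ∣ℤ laguerreTerm (suc d) n m (suc d)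
    p∣last = ∣sumToℤ⇒∣last d (subst (+ p ∣ℤ_) (sym sum≡0) ∣0ℤ)
      (λ k k≤d → p∣laguerreTerm p∣d k (s≤s k≤d))
    ∣last∣≡ : ℤ.∣ laguerreTerm (suc d) n m (suc d) ∣ ≡ ℤ.∣ n ∣ ^ suc d
    ∣last∣≡ = begin
      ℤ.∣ laguerreTerm (suc d) n m (suc d) ∣   ≡⟨ cong ℤ.∣_∣ (laguerreTerm-last (suc d) n m) ⟩
      ℤ.∣ -1ℤ ℤ.^ suc d ℤ.* n ℤ.^ suc d ∣      ≡⟨ ℤ.abs-* (-1ℤ ℤ.^ suc d) (n ℤ.^ suc d) ⟩
      ℤ.∣ -1ℤ ℤ.^ suc d ∣ * ℤ.∣ n ℤ.^ suc d ∣  ≡⟨ cong₂ _*_ (∣i^n∣≡∣i∣^n -1ℤ (suc d)) (∣i^n∣≡∣i∣^n n (suc d)) ⟩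
      1 ^ suc d * ℤ.∣ n ∣ ^ suc d              ≡⟨ cong (_* ℤ.∣ n ∣ ^ suc d) (^-zeroˡ (suc d)) ⟩
      1 * ℤ.∣ n ∣ ^ suc d                      ≡⟨ *-identityˡ (ℤ.∣ n ∣ ^ suc d) ⟩
      ℤ.∣ n ∣ ^ suc d                          ∎
      where open ≡-Reasoning

  p∣n⇒p∣m : ∀ {d} → sumToℤ d (laguerreTerm d n m) ≡ 0ℤ → p ∣ ℤ.∣ n ∣ → p ∣ ℤ.∣ m ∣
  p∣n⇒p∣m {zero}  ()
  p∣n⇒p∣m {suc d} sum≡0 p∣n with valuation[k!]<k p-prime (suc d) z<s
  ... | e , _ , w , p∤w , d!≡p^e*w =
    p∣m^k⇒p∣m p-prime (suc d) (p^[1+e]∣p^e*u*m⇒p∣m p-prime {e} p∤w p^[1+e]∣p^e*w*∣m∣^d)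
    where
    p^[1+e]∣first : + (p ^ suc e) ∣ℤ laguerreTerm (suc d) n m 0
    p^[1+e]∣first = ∣sumToℤ⇒∣head (suc d) (subst (_ ∣ℤ_) (sym sum≡0) ∣0ℤ)
      (p^[1+e]∣laguerreTerm p-prime p∣n {e} (divides w (trans d!≡p^e*w (*-comm (p ^ e) w))))
    p^[1+e]∣p^e*w*∣m∣^d : p ^ suc e ∣ p ^ e * w * ℤ.∣ m ∣ ^ suc d
    p^[1+e]∣p^e*w*∣m∣^d = subst (p ^ suc e ∣_) ∣first∣≡ (ℤ.∣⇒∣ᵤ p^[1+e]∣first)
      where
      ∣first∣≡ : ℤ.∣ laguerreTerm (suc d) n m 0 ∣ ≡ p ^ e * w * ℤ.∣ m ∣ ^ suc d
      ∣first∣≡ = trans (cong ℤ.∣_∣ (laguerreTerm-first (suc d) n m))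
        (trans (ℤ.abs-* (+ (suc d !)) (m ℤ.^ suc d)) (cong₂ _*_ d!≡p^e*w (∣i^n∣≡∣i∣^n m (suc d))))

mainTheorem3 : (d : ℕ) → 2 ≤ d → (x : ℚ) → ¬ (laguerreEval d x ≡ 0ℚ)
mainTheorem3 d 2≤d x@(mkℚ n m-1 n⊥m) root with ∃-prime∣ 2≤d
... | p , p-prime , p∣d =
  nonTrivial⇒≢1 {{prime⇒nonTrivial p-prime}} (Coprime.recompute n⊥m (p∣n , p∣m))
  where
  m = suc m-1
  mx≡n : ι (+ m) ℚ.* x ≡ ι n
  mx≡n = trans (cong (ι (+ m) ℚ.*_) (sym (ℚ.↥p/↧p≡p x))) (ι[n]*[i/n]≡ι[i] m n)
  sum≡0 : sumToℤ d (laguerreTerm d n (+ m)) ≡ 0ℤ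
  sum≡0 = laguerreRoot⇒sumToℤ≡0 mx≡n d root
  p∣n : p ∣ ℤ.∣ n ∣
  p∣n = p∣d⇒p∣n p-prime {n} {+ m} {d} sum≡0 p∣d
  p∣m : p ∣ m
  p∣m = p∣n⇒p∣m p-prime {n} {+ m} {d} sum≡0 p∣n
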